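{- Let $G$ be a finite simple graph with minimum degree $\delta=\delta(G)\ge 2$ and maximum degree $\Delta=\Delta(G)$, and let $T$ be an independent set of $G$. Then the vertices of $T$ can be colored with $\lceil (4\Delta^2)^{\frac{1}{\delta-1}}\rceil$ colors in such a way that for every vertex $u\in V(G)$ with $N(u)\subseteq T$, the set $N(u)$ contains vertices of at least two different colors.
   Context: $N(u)$ denotes the set of neighbours of $u$. -}

module Defs where

open import Data.Nat using (ℕ; _≤_; _<_; _^_)
open import Data.Fin using (Fin)
open import Data.Bool using (Bool; true; false)
open import Data.List using (length; filterᵇ; allFin)
open import Data.Product using (∃; _×_)
open import Relation.Binary.PropositionalEquality using (_≡_)

record SimpleGraph (n : ℕ) : Set where
  field
    adj     : Fin n → Fin n → Bool
    symm    : ∀ u v → adj u v ≡ adj v u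
    irrefl  : ∀ u → adj u u ≡ false

open SimpleGraph public

degree : ∀ {n} → SimpleGraph n → Fin n → ℕ
degree {n} G v = length (filterᵇ (adj G v) (allFin n))

IsMinDegree : ∀ {n} → SimpleGraph n → ℕ → Set
IsMinDegree {n} G δ = (∃ λ v → degree G v ≡ δ) × (∀ v → δ ≤ degree G v)

IsMaxDegree : ∀ {n} → SimpleGraph n → ℕ → Set
IsMaxDegree {n} G Δ = (∃ λ v → degree G v ≡ Δ) × (∀ v → degree G v ≤ Δ)

IsIndependent : ∀ {n} → SimpleGraph n → (Fin n → Bool) → Set
IsIndependent G T = ∀ u v → T u ≡ true → T v ≡ true → adj G u v ≡ false

-- k = ⌈ x ^ (1/m) ⌉ for natural x and m ≥ 1, i.e. k is the least natural
-- number with x ≤ k ^ m  (for k ≥ 0: k ≥ x^(1/m) ⟺ k^m ≥ x).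
IsCeilRoot : ℕ → ℕ → ℕ → Set
IsCeilRoot m x k = (x ≤ k ^ m) × (∀ j → j < k → j ^ m < x)

module Submission where

open import Defs
open import Data.Nat using (ℕ; _≤_; _*_; _^_; _∸_)
open import Data.Fin using (Fin)
open import Data.Bool using (Bool; true)
open import Data.Product using (Σ; ∃; _×_)
open import Relation.Binary.PropositionalEquality using (_≡_; _≢_)
open import Data.Nat using (zero; suc; _<_; _+_; z≤n; s≤s; NonZero; >-nonZero)
open import Data.Nat.Properties
  using ( ≤-refl; ≤-reflexive; ≤-trans; m≤n⇒m≤1+n; module ≤-Reasoning
        ; +-identityʳ; +-mono-≤; +-monoʳ-≤; +-cancelʳ-≤
        ; *-zeroʳ; *-identityʳ; *-assoc; *-comm; *-distribˡ-+
        ; *-mono-≤; *-monoˡ-≤; *-monoʳ-≤; *-cancelˡ-≤; *-cancelʳ-≤; *-cancelˡ-<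
        ; m^n≢0; m^n>0; ^-monoʳ-≤
        ; +-*-semiring; +-commutativeSemigroup; *-commutativeSemigroup )
open import Data.Nat.Induction using (<-rec)
open import Data.Nat.Tactic.RingSolver using (solve-∀)
open import Data.Fin using (zero; suc)
open import Data.Fin.Properties using (_≟_)
open import Data.Bool using (false; _∧_; _∨_; not; if_then_else_)
open import Data.Bool.Properties using (∧-zeroʳ; ∧-distribˡ-∨; ∧-comm; ∨-zeroʳ)
open import Data.Product using (_,_; proj₁; proj₂)
open import Data.List using (length; filterᵇ; tabulate)
open import Data.Vec.Functional using (Vector; []; _∷_)
open import Function using (_∘_)
open import Relation.Binary.PropositionalEquality using (refl; sym; trans; cong; cong₂; subst; module ≡-Reasoning)
open import Relation.Nullary.Decidable using (does; yes; no; dec-true; dec-false)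
open import Algebra.Properties.Semiring.Sum +-*-semiring using (sum; sum-cong-≗; *-distribʳ-sum)
open import Algebra.Properties.CommutativeSemigroup +-commutativeSemigroup using (interchange)
open import Algebra.Properties.CommutativeSemigroup *-commutativeSemigroup using (x∙yz≈y∙xz)

-- Colour every vertex independently and uniformly with one of k colours.  The
-- bad event "N(u) is monochromatic" has probability at most k^(1-δ) ≤ 1/(4Δ²),
-- depends only on the colours of the ≤ Δ vertices of N(u), and every vertex
-- lies in ≤ Δ neighbourhoods.  The symmetric Lovász Local Lemma then yields a
-- colouring in which no neighbourhood is monochromatic; restricted to T it is
-- the required colouring.
--
-- There are no real numbers here, so probabilities are replaced by counts of
-- colourings (k^n in total) and every estimate is multiplied out.

allᵇ : ∀ {m} → (Fin m → Bool) → Bool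
allᵇ {zero}  p = true
allᵇ {suc m} p = p zero ∧ allᵇ (p ∘ suc)

anyᵇ : ∀ {m} → (Fin m → Bool) → Bool
anyᵇ {zero}  p = false
anyᵇ {suc m} p = p zero ∨ anyᵇ (p ∘ suc)

allᵇ-intro : ∀ {m} (p : Fin m → Bool) → (∀ x → p x ≡ true) → allᵇ p ≡ true
allᵇ-intro {zero}  p h = refl
allᵇ-intro {suc m} p h rewrite h zero = allᵇ-intro (p ∘ suc) (h ∘ suc)

allᵇ-elim : ∀ {m} (p : Fin m → Bool) → allᵇ p ≡ true → ∀ x → p x ≡ true
allᵇ-elim {suc m} p h x with p zero in p0
allᵇ-elim {suc m} p h zero    | true = p0
allᵇ-elim {suc m} p h (suc x) | true = allᵇ-elim (p ∘ suc) h x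

allᵇ-false : ∀ {m} (p : Fin m → Bool) → allᵇ p ≡ false → ∃ λ x → p x ≡ false
allᵇ-false {suc m} p h with p zero in p0
... | false = zero , p0
... | true with allᵇ-false (p ∘ suc) h
...   | x , px = suc x , px

anyᵇ-intro : ∀ {m} (p : Fin m → Bool) x → p x ≡ true → anyᵇ p ≡ true
anyᵇ-intro {suc m} p zero    px rewrite px = refl
anyᵇ-intro {suc m} p (suc x) px with p zero
... | true  = refl
... | false = anyᵇ-intro (p ∘ suc) x px

anyᵇ-witness : ∀ {m} (p : Fin m → Bool) → anyᵇ p ≡ true → ∃ λ x → p x ≡ true
anyᵇ-witness {suc m} p h with p zero in p0
... | true = zero , p0
... | false with anyᵇ-witness (p ∘ suc) h
...   | x , px = suc x , px

anyᵇ-elim : ∀ {m} (p : Fin m → Bool) → anyᵇ p ≡ false → ∀ x → p x ≡ false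
anyᵇ-elim {suc m} p h x with p zero in p0
anyᵇ-elim {suc m} p h zero    | false = p0
anyᵇ-elim {suc m} p h (suc x) | false = anyᵇ-elim (p ∘ suc) h x

allᵇ-cong : ∀ {m} {p q : Fin m → Bool} → (∀ x → p x ≡ q x) → allᵇ p ≡ allᵇ q
allᵇ-cong {zero}  h = refl
allᵇ-cong {suc m} h = cong₂ _∧_ (h zero) (allᵇ-cong (h ∘ suc))

anyᵇ-cong : ∀ {m} {p q : Fin m → Bool} → (∀ x → p x ≡ q x) → anyᵇ p ≡ anyᵇ q
anyᵇ-cong {zero}  h = refl
anyᵇ-cong {suc m} h = cong₂ _∨_ (h zero) (anyᵇ-cong (h ∘ suc))

∧-intro : ∀ {a b} → a ≡ true → b ≡ true → a ∧ b ≡ true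
∧-intro refl refl = refl

∧-elimˡ : ∀ {a b} → a ∧ b ≡ true → a ≡ true
∧-elimˡ {true} _ = refl

∧-elimʳ : ∀ {a b} → a ∧ b ≡ true → b ≡ true
∧-elimʳ {true} h = h

Subset : ℕ → Set
Subset m = Fin m → Bool

_⊆_ : ∀ {m} → Subset m → Subset m → Set
S ⊆ S′ = ∀ x → S x ≡ true → S′ x ≡ true

size : ∀ {m} → Subset m → ℕ
size {zero}  S = 0
size {suc m} S = (if S zero then 1 else 0) + size (S ∘ suc)

size-full : ∀ m → size {m} (λ _ → true) ≡ m
size-full zero    = refl
size-full (suc m) = cong suc (size-full m)

size-mono : ∀ {m} {S S′ : Subset m} → S ⊆ S′ → size S ≤ size S′
size-mono {zero}          h = z≤n
size-mono {suc m} {S} {S′} h with S zero in s0 | S′ zero in s0′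
... | true  | true  = s≤s (size-mono (h ∘ suc))
... | true  | false with trans (sym (h zero s0)) s0′
...   | ()
size-mono {suc m} h | false | true  = m≤n⇒m≤1+n (size-mono (h ∘ suc))
size-mono {suc m} h | false | false = size-mono (h ∘ suc)

size-strict : ∀ {m} {S S′ : Subset m} → S ⊆ S′ → ∀ x → S′ x ≡ true → S x ≡ false → size S < size S′
size-strict {suc m} {S} {S′} h zero s′ s rewrite s′ | s = s≤s (size-mono (h ∘ suc))
size-strict {suc m} {S} {S′} h (suc x) s′ s with S zero in s0 | S′ zero in s0′
... | true  | true  = s≤s (size-strict (h ∘ suc) x s′ s)
... | true  | false with trans (sym (h zero s0)) s0′
...   | ()
size-strict {suc m} h (suc x) s′ s | false | true  = m≤n⇒m≤1+n (size-strict (h ∘ suc) x s′ s)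
size-strict {suc m} h (suc x) s′ s | false | false = size-strict (h ∘ suc) x s′ s

size-witness : ∀ {m} (S : Subset m) → 0 < size S → ∃ λ x → S x ≡ true
size-witness {suc m} S h with S zero in s0
... | true = zero , s0
... | false with size-witness (S ∘ suc) h
...   | x , sx = suc x , sx

size-induction : ∀ {m} (P : Subset m → Set) →
                 (∀ S → (∀ S′ → size S′ < size S → P S′) → P S) → ∀ S → P S
size-induction P step S = <-rec Q stepQ (size S) S refl
  where
  Q : ℕ → Set
  Q s = ∀ S → size S ≡ s → P S
  stepQ : ∀ s → (∀ {s′} → s′ < s → Q s′) → Q s
  stepQ s ih S′ refl = step S′ (λ S″ smaller → ih smaller S″ refl)

sum-mono : ∀ {m} {f g : Fin m → ℕ} → (∀ x → f x ≤ g x) → sum f ≤ sum g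
sum-mono {zero}  h = z≤n
sum-mono {suc m} h = +-mono-≤ (h zero) (sum-mono (h ∘ suc))

sum-+ : ∀ {m} (f g : Fin m → ℕ) → sum (λ x → f x + g x) ≡ sum f + sum g
sum-+ {zero}  f g = refl
sum-+ {suc m} f g = trans (cong (f zero + g zero +_) (sum-+ (f ∘ suc) (g ∘ suc)))
                          (interchange (f zero) (g zero) (sum (f ∘ suc)) (sum (g ∘ suc)))

sum-const : ∀ m c → sum {m} (λ _ → c) ≡ m * c
sum-const zero    c = refl
sum-const (suc m) c = cong (c +_) (sum-const m c)

sum-delta : ∀ {m} (c : Fin m) t → sum (λ x → if does (x ≟ c) then t else 0) ≡ t
sum-delta {suc m} zero    t = trans (cong (t +_) (sum-const m 0)) (trans (cong (t +_) (*-zeroʳ m)) (+-identityʳ t))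
sum-delta {suc m} (suc c) t = sum-delta c t

sum-witness : ∀ {m} (f : Fin m → ℕ) → 0 < sum f → ∃ λ x → 0 < f x
sum-witness {suc m} f h with f zero in f0
... | suc _ = zero , subst (0 <_) (sym f0) (s≤s z≤n)
... | zero with sum-witness (f ∘ suc) h
...   | x , fx = suc x , fx

-- Σ d · (m·M) = Σ a · Σ b  when b is constant and d c · M = a c · b c;
-- this is the inductive step of the product rule for independent events.
sum-product : ∀ {m} M (a b d : Fin m → ℕ) → (∀ c c′ → b c ≡ b c′) → (∀ c → d c * M ≡ a c * b c) →
              sum d * (m * M) ≡ sum a * sum b
sum-product {zero}  M a b d b-const hd = refl
sum-product {suc m} M a b d b-const hd =
  begin
    sum d * (suc m * M)                ≡⟨ x∙yz≈y∙xz (sum d) (suc m) M ⟩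
    suc m * (sum d * M)                ≡⟨ cong (suc m *_) (*-distribʳ-sum M d) ⟩
    suc m * sum (λ c → d c * M)        ≡⟨ cong (suc m *_) (sum-cong-≗ λ c → trans (hd c) (cong (a c *_) (b-const c zero))) ⟩
    suc m * sum (λ c → a c * β)        ≡⟨ cong (suc m *_) (sym (*-distribʳ-sum β a)) ⟩
    suc m * (sum a * β)                ≡⟨ x∙yz≈y∙xz (suc m) (sum a) β ⟩
    sum a * (suc m * β)                ≡⟨ cong (sum a *_) (sym (trans (sum-cong-≗ λ c → b-const c zero) (sum-const (suc m) β))) ⟩
    sum a * sum b                      ∎
  where
  open ≡-Reasoning
  β : ℕ
  β = b zero

-- If x ≤ y + z where z is at most half of x, then x is at most twice y.
-- This is the arithmetic core of both induction steps of the local lemma.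
absorb-half : ∀ {x y z} → x ≤ y + z → 2 * z ≤ x → x ≤ 2 * y
absorb-half {x} {y} {z} x≤y+z 2z≤x = +-cancelʳ-≤ x x (2 * y)
  (begin
     x + x          ≡⟨ cong (x +_) (sym (+-identityʳ x)) ⟩
     2 * x          ≤⟨ *-monoʳ-≤ 2 x≤y+z ⟩
     2 * (y + z)    ≡⟨ *-distribˡ-+ 2 y z ⟩
     2 * y + 2 * z  ≤⟨ +-monoʳ-≤ (2 * y) 2z≤x ⟩
     2 * y + x      ∎)
  where open ≤-Reasoning

module Colourings (k : ℕ) where

  Colouring : ℕ → Set
  Colouring n = Vector (Fin k) n

  Event : ℕ → Set
  Event n = Colouring n → Bool

  count : ∀ {n} → Event n → ℕ
  count {zero}  E = if E [] then 1 else 0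
  count {suc n} E = sum (λ c → count (λ v → E (c ∷ v)))

  count-cong : ∀ {n} {E F : Event n} → (∀ v → E v ≡ F v) → count E ≡ count F
  count-cong {zero}  h rewrite h [] = refl
  count-cong {suc n} h = sum-cong-≗ λ c → count-cong (λ v → h (c ∷ v))

  count-mono : ∀ {n} {E F : Event n} → (∀ v → E v ≡ true → F v ≡ true) → count E ≤ count F
  count-mono {zero} {E} {F} h with E [] in e
  ... | false = z≤n
  ... | true rewrite h [] e = ≤-refl
  count-mono {suc n} h = sum-mono λ c → count-mono (λ v → h (c ∷ v))

  count-∨ : ∀ {n} (E F : Event n) → count (λ v → E v ∨ F v) ≤ count E + count F
  count-∨ {zero} E F with E [] | F []
  ... | true  | true  = s≤s z≤n
  ... | true  | false = ≤-refl
  ... | false | _     = ≤-refl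
  count-∨ {suc n} E F = ≤-trans (sum-mono {k} λ c → count-∨ (λ v → E (c ∷ v)) (λ v → F (c ∷ v)))
                                (≤-reflexive (sum-+ {k} _ _))

  count-true : ∀ n → count {n} (λ _ → true) ≡ k ^ n
  count-true zero    = refl
  count-true (suc n) = trans (sum-cong-≗ {k} λ _ → count-true n) (sum-const k (k ^ n))

  count-false : ∀ n → count {n} (λ _ → false) ≡ 0
  count-false zero    = refl
  count-false (suc n) = trans (sum-cong-≗ {k} λ _ → count-false n) (trans (sum-const k 0) (*-zeroʳ k))

  count-witness : ∀ {n} (E : Event n) → 0 < count E → ∃ λ v → E v ≡ true
  count-witness {zero} E h with E [] in e
  ... | true = [] , e
  count-witness {suc n} E h with sum-witness _ h
  ... | c , hc with count-witness _ hc
  ...   | v , ev = (c ∷ v) , ev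

  count-guard : ∀ {n} b (E : Event n) → count (λ v → b ∧ E v) ≡ (if b then count E else 0)
  count-guard true  E = refl
  count-guard {n} false E = count-false n

  union-bound : ∀ {n m} K B (g : Event n) (p : Subset m) (F : Fin m → Event n) →
                (∀ x → p x ≡ true → K * count (λ v → g v ∧ F x v) ≤ B) →
                K * count (λ v → g v ∧ anyᵇ (λ x → p x ∧ F x v)) ≤ size p * B
  union-bound {n} {zero} K B g p F h =
    ≤-reflexive (trans (cong (K *_) (trans (count-cong λ v → ∧-zeroʳ (g v)) (count-false n))) (*-zeroʳ K))
  union-bound {n} {suc m} K B g p F h with p zero in p0
  ... | false = union-bound K B g (p ∘ suc) (F ∘ suc) (h ∘ suc)
  ... | true  =
    begin
      K * count (λ v → g v ∧ (F zero v ∨ rest v))                    ≤⟨ *-monoʳ-≤ K split ⟩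
      K * (count (λ v → g v ∧ F zero v) + count (λ v → g v ∧ rest v)) ≡⟨ *-distribˡ-+ K _ _ ⟩
      K * count (λ v → g v ∧ F zero v) + K * count (λ v → g v ∧ rest v)
                                    ≤⟨ +-mono-≤ (h zero p0) (union-bound K B g (p ∘ suc) (F ∘ suc) (h ∘ suc)) ⟩
      B + size (p ∘ suc) * B                                         ∎
    where
    open ≤-Reasoning
    rest : Event n
    rest v = anyᵇ (λ x → p (suc x) ∧ F (suc x) v)
    split : count (λ v → g v ∧ (F zero v ∨ rest v)) ≤ count (λ v → g v ∧ F zero v) + count (λ v → g v ∧ rest v)
    split = ≤-trans (≤-reflexive (count-cong λ v → ∧-distribˡ-∨ (g v) (F zero v) (rest v)))
                    (count-∨ (λ v → g v ∧ F zero v) (λ v → g v ∧ rest v))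

  DependsOn : ∀ {n} → Subset n → Event n → Set
  DependsOn X E = ∀ v w → (∀ i → X i ≡ true → v i ≡ w i) → E v ≡ E w

  DependsOn-mono : ∀ {n} {X Y : Subset n} {E : Event n} → X ⊆ Y → DependsOn X E → DependsOn Y E
  DependsOn-mono X⊆Y dE v w agree = dE v w λ i x → agree i (X⊆Y i x)

  DependsOn-tail : ∀ {n} {X : Subset (suc n)} {E : Event (suc n)} →
                   DependsOn X E → ∀ c → DependsOn (X ∘ suc) (λ v → E (c ∷ v))
  DependsOn-tail dE c v w agree = dE (c ∷ v) (c ∷ w) λ { zero _ → refl ; (suc i) x → agree i x }

  count-ignoring-head : ∀ {n} {X : Subset (suc n)} {E : Event (suc n)} → X zero ≡ false →
                        DependsOn X E → ∀ c c′ → count (λ v → E (c ∷ v)) ≡ count (λ v → E (c′ ∷ v))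
  count-ignoring-head {X = X} x0 dE c c′ = count-cong λ v → dE (c ∷ v) (c′ ∷ v) (agree v)
    where
    agree : ∀ v i → X i ≡ true → (c ∷ v) i ≡ (c′ ∷ v) i
    agree v zero    x with trans (sym x0) x
    ... | ()
    agree v (suc i) x = refl

  -- By induction on n: the first
  -- coordinate is irrelevant to E or to F, which is the situation of sum-product.
  product-rule : ∀ {n} (X : Subset n) {E F : Event n} → DependsOn X E → DependsOn (not ∘ X) F →
                 count (λ v → E v ∧ F v) * k ^ n ≡ count E * count F
  product-rule {zero} X {E} {F} dE dF with E [] | F []
  ... | true  | true  = refl
  ... | true  | false = refl
  ... | false | _     = refl
  product-rule {suc n} X {E} {F} dE dF with X zero in x0
  ... | true  = sum-product (k ^ n) _ _ _ (count-ignoring-head (cong not x0) dF)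
                  (λ c → product-rule (X ∘ suc) (DependsOn-tail dE c) (DependsOn-tail dF c))
  ... | false = trans (sum-product (k ^ n) _ _ _ (count-ignoring-head x0 dE)
                         (λ c → trans (product-rule (X ∘ suc) (DependsOn-tail dE c) (DependsOn-tail dF c))
                                      (*-comm (count (λ v → E (c ∷ v))) _)))
                      (*-comm (count F) (count E))

  ColouredWith : ∀ {n} → Subset n → Fin k → Event n
  ColouredWith X c v = allᵇ (λ i → not (X i) ∨ does (v i ≟ c))

  count-ColouredWith : ∀ {n} (X : Subset n) c → k ^ size X * count (ColouredWith X c) ≡ k ^ n
  count-ColouredWith {zero}  X c = refl
  count-ColouredWith {suc n} X c with X zero
  ... | false =
    begin
      k ^ size (X ∘ suc) * sum {k} (λ _ → count rest)   ≡⟨ cong (k ^ size (X ∘ suc) *_) (sum-const k (count rest)) ⟩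
      k ^ size (X ∘ suc) * (k * count rest)            ≡⟨ x∙yz≈y∙xz (k ^ size (X ∘ suc)) k (count rest) ⟩
      k * (k ^ size (X ∘ suc) * count rest)            ≡⟨ cong (k *_) (count-ColouredWith (X ∘ suc) c) ⟩
      k * k ^ n                                        ∎
    where
    open ≡-Reasoning
    rest : Event n
    rest = ColouredWith (X ∘ suc) c
  ... | true =
    begin
      k * k ^ size (X ∘ suc) * sum (λ c′ → count (λ v → does (c′ ≟ c) ∧ rest v))
        ≡⟨ cong (k * k ^ size (X ∘ suc) *_) (sum-cong-≗ λ c′ → count-guard (does (c′ ≟ c)) rest) ⟩
      k * k ^ size (X ∘ suc) * sum (λ c′ → if does (c′ ≟ c) then count rest else 0)
        ≡⟨ cong (k * k ^ size (X ∘ suc) *_) (sum-delta c (count rest)) ⟩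
      k * k ^ size (X ∘ suc) * count rest
        ≡⟨ *-assoc k _ _ ⟩
      k * (k ^ size (X ∘ suc) * count rest)
        ≡⟨ cong (k *_) (count-ColouredWith (X ∘ suc) c) ⟩
      k * k ^ n ∎
    where
    open ≡-Reasoning
    rest : Event n
    rest = ColouredWith (X ∘ suc) c

  ColouredWith-dependsOn : ∀ {n} (X : Subset n) c → DependsOn X (ColouredWith X c)
  ColouredWith-dependsOn X c v w agree = allᵇ-cong same
    where
    same : ∀ i → (not (X i) ∨ does (v i ≟ c)) ≡ (not (X i) ∨ does (w i ≟ c))
    same i with X i in x
    ... | true  = cong (λ colour → does (colour ≟ c)) (agree i x)
    ... | false = refl

  Monochromatic : ∀ {n} → Subset n → Event n
  Monochromatic X v = anyᵇ (λ c → ColouredWith X c v)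

  Monochromatic-dependsOn : ∀ {n} (X : Subset n) → DependsOn X (Monochromatic X)
  Monochromatic-dependsOn X v w agree = anyᵇ-cong λ c → ColouredWith-dependsOn X c v w agree

  count-Monochromatic : ∀ {n} (X : Subset n) → k ^ size X * count (Monochromatic X) ≤ k * k ^ n
  count-Monochromatic {n} X =
    subst (k ^ size X * count (Monochromatic X) ≤_) (cong (_* k ^ n) (size-full k))
      (union-bound (k ^ size X) (k ^ n) (λ _ → true) (λ _ → true) (ColouredWith X)
                   (λ c _ → ≤-reflexive (count-ColouredWith X c)))

  -- The bad events B j depend on supports X j of at most a coordinates, and
  -- every coordinate lies in at most b supports, so each B j shares
  -- coordinates with at most a·b events.
  module LocalLemma {m n} .{{_ : NonZero k}} (K a b : ℕ)
    (B : Fin m → Event n) (X : Fin m → Subset n)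
    (B-dependsOn : ∀ j → DependsOn (X j) (B j))
    (support : ∀ j → size (X j) ≤ a)
    (multiplicity : ∀ w → size (λ j → X j w) ≤ b)
    (rare : ∀ j → K * count (B j) ≤ k ^ n)
    (4≤K : 4 ≤ K) (4ab≤K : 4 * (a * b) ≤ K)
    where

    instance
      K≢0 : NonZero K
      K≢0 = >-nonZero (≤-trans (s≤s z≤n) 4≤K)

    Avoids : Subset m → Event n
    Avoids S v = allᵇ (λ j → not (S j) ∨ not (B j v))

    Avoids-intro : ∀ S v → (∀ j → S j ≡ true → B j v ≡ false) → Avoids S v ≡ true
    Avoids-intro S v h = allᵇ-intro _ ok
      where
      ok : ∀ j → (not (S j) ∨ not (B j v)) ≡ true
      ok j with S j in s
      ... | false = refl
      ... | true rewrite h j s = refl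

    Avoids-elim : ∀ S v → Avoids S v ≡ true → ∀ j → S j ≡ true → B j v ≡ false
    Avoids-elim S v h j s with allᵇ-elim _ h j
    ... | ok rewrite s with B j v
    ...   | false = refl

    Avoids-false : ∀ S v → Avoids S v ≡ false → ∃ λ j → S j ≡ true × B j v ≡ true
    Avoids-false S v h with allᵇ-false _ h
    ... | j , fails with S j in s | B j v in bj
    ...   | true | true = j , s , bj
    Avoids-false S v h | j , () | true  | false
    Avoids-false S v h | j , () | false | _

    Avoids-anti : ∀ {S S′} → S ⊆ S′ → ∀ v → Avoids S′ v ≡ true → Avoids S v ≡ true
    Avoids-anti S⊆S′ v h = Avoids-intro _ v λ j s → Avoids-elim _ v h j (S⊆S′ j s)

    Avoids-dependsOn : ∀ {Y} S → (∀ j → S j ≡ true → DependsOn Y (B j)) → DependsOn Y (Avoids S)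
    Avoids-dependsOn S dB v w agree = allᵇ-cong same
      where
      same : ∀ j → (not (S j) ∨ not (B j v)) ≡ (not (S j) ∨ not (B j w))
      same j with S j in s
      ... | false = refl
      ... | true  = cong not (dB j s v w agree)

    Disjoint : Fin m → Fin m → Bool
    Disjoint i j = allᵇ (λ w → not (X i w ∧ X j w))

    Disjoint-⊆ : ∀ i j → Disjoint i j ≡ true → X j ⊆ (not ∘ X i)
    Disjoint-⊆ i j disj w xj with allᵇ-elim _ disj w
    ... | ok rewrite xj with X i w
    ...   | false = refl

    Disjoint-false : ∀ i j → Disjoint i j ≡ false → ∃ λ w → X i w ≡ true × X j w ≡ true
    Disjoint-false i j h with allᵇ-false _ h
    ... | w , meets with X i w in xi | X j w in xj
    ...   | true | true = w , xi , xj
    Disjoint-false i j h | w , () | true  | false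
    Disjoint-false i j h | w , () | false | _

    -- Avoiding only events whose supports miss X i does not change the
    -- probability of B i (product rule), so P(B i | Avoids S) ≤ 1/K.
    isolated : ∀ S i → (∀ j → S j ≡ true → Disjoint i j ≡ true) →
               K * count (λ v → Avoids S v ∧ B i v) ≤ count (Avoids S)
    isolated S i disj = *-cancelʳ-≤ _ _ (k ^ n) {{m^n≢0 k n}}
      (begin
        K * count (λ v → Avoids S v ∧ B i v) * k ^ n    ≡⟨ *-assoc K _ _ ⟩
        K * (count (λ v → Avoids S v ∧ B i v) * k ^ n)  ≡⟨ cong (λ c → K * (c * k ^ n)) (count-cong λ v → ∧-comm (Avoids S v) (B i v)) ⟩
        K * (count (λ v → B i v ∧ Avoids S v) * k ^ n)  ≡⟨ cong (K *_) (product-rule (X i) (B-dependsOn i) (Avoids-dependsOn S outside)) ⟩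
        K * (count (B i) * count (Avoids S))            ≡⟨ sym (*-assoc K _ _) ⟩
        K * count (B i) * count (Avoids S)              ≤⟨ *-monoˡ-≤ _ (rare i) ⟩
        k ^ n * count (Avoids S)                        ≡⟨ *-comm (k ^ n) _ ⟩
        count (Avoids S) * k ^ n                        ∎)
      where
      open ≤-Reasoning
      outside : ∀ j → S j ≡ true → DependsOn (not ∘ X i) (B j)
      outside j s = DependsOn-mono (Disjoint-⊆ i j (disj j s)) (B-dependsOn j)

    far near : Fin m → Subset m → Subset m
    far  i S j = S j ∧ Disjoint i j
    near i S j = S j ∧ not (Disjoint i j)

    far-smaller : ∀ S i j → near i S j ≡ true → size (far i S) < size S
    far-smaller S i j nj with S j in s | Disjoint i j in d
    ... | true  | false = size-strict (λ _ → ∧-elimˡ) j s (cong₂ _∧_ s d)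
    far-smaller S i j () | true  | true
    far-smaller S i j () | false | _

    NearHit : Fin m → Subset m → Event n
    NearHit i S v = anyᵇ (λ w → X i w ∧ anyᵇ (λ j → (near i S j ∧ X j w) ∧ B j v))

    far-cover : ∀ S i v → Avoids (far i S) v ≡ true →
                (Avoids S v ∨ (Avoids (far i S) v ∧ NearHit i S v)) ≡ true
    far-cover S i v h with Avoids S v in e
    ... | true  = refl
    ... | false with Avoids-false S v e
    ...   | j , s , bj with Disjoint i j in d
    ...     | true with trans (sym (Avoids-elim (far i S) v h j (∧-intro s d))) bj
    ...       | ()
    far-cover S i v h | false | j , s , bj | false with Disjoint-false i j d
    ... | w , xi , xj rewrite h =
      anyᵇ-intro _ w (∧-intro xi (anyᵇ-intro _ j (∧-intro (∧-intro (∧-intro s (cong not d)) xj) bj)))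

    -- Union bound through the two levels of NearHit: a coordinates w ∈ X i,
    -- each in at most b supports, each event conditionally ≤ 2/K likely.
    nearHit-bound : ∀ S i →
      (∀ j → near i S j ≡ true → K * count (λ v → Avoids (far i S) v ∧ B j v) ≤ 2 * count (Avoids (far i S))) →
      K * count (λ v → Avoids (far i S) v ∧ NearHit i S v) ≤ a * (b * (2 * count (Avoids (far i S))))
    nearHit-bound S i bound =
      ≤-trans (union-bound K _ (Avoids (far i S)) (X i) _ perCoordinate) (*-monoˡ-≤ _ (support i))
      where
      perCoordinate : ∀ w → X i w ≡ true →
        K * count (λ v → Avoids (far i S) v ∧ anyᵇ (λ j → (near i S j ∧ X j w) ∧ B j v)) ≤ b * (2 * count (Avoids (far i S)))
      perCoordinate w _ =
        ≤-trans (union-bound K _ (Avoids (far i S)) (λ j → near i S j ∧ X j w) B (λ j h → bound j (∧-elimˡ h)))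
                (*-monoˡ-≤ _ (≤-trans (size-mono {S = λ j → near i S j ∧ X j w} (λ _ → ∧-elimʳ)) (multiplicity w)))

    far-double : ∀ S i →
      (∀ j → near i S j ≡ true → K * count (λ v → Avoids (far i S) v ∧ B j v) ≤ 2 * count (Avoids (far i S))) →
      count (Avoids (far i S)) ≤ 2 * count (Avoids S)
    far-double S i bound = *-cancelˡ-≤ K (begin
        K * F        ≤⟨ absorb-half {z = K * U} split halfHit ⟩
        2 * (K * C)  ≡⟨ x∙yz≈y∙xz 2 K C ⟩
        K * (2 * C)  ∎)
      where
      open ≤-Reasoning
      F C U : ℕ
      F = count (Avoids (far i S))
      C = count (Avoids S)
      U = count (λ v → Avoids (far i S) v ∧ NearHit i S v)
      split : K * F ≤ K * C + K * U
      split = ≤-trans (*-monoʳ-≤ K (≤-trans (count-mono (far-cover S i)) (count-∨ (Avoids S) _)))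
                      (≤-reflexive (*-distribˡ-+ K C U))
      regroup : ∀ a b x → 2 * (a * (b * (2 * x))) ≡ 4 * (a * b) * x
      regroup = solve-∀
      halfHit : 2 * (K * U) ≤ K * F
      halfHit = begin
        2 * (K * U)                  ≤⟨ *-monoʳ-≤ 2 (nearHit-bound S i bound) ⟩
        2 * (a * (b * (2 * F)))      ≡⟨ regroup a b F ⟩
        4 * (a * b) * F              ≤⟨ *-monoˡ-≤ F 4ab≤K ⟩
        K * F                        ∎

    conditional : ∀ S i → K * count (λ v → Avoids S v ∧ B i v) ≤ 2 * count (Avoids S)
    conditional = size-induction _ step
      where
      step : ∀ S → (∀ S′ → size S′ < size S → ∀ i → K * count (λ v → Avoids S′ v ∧ B i v) ≤ 2 * count (Avoids S′)) →
             ∀ i → K * count (λ v → Avoids S v ∧ B i v) ≤ 2 * count (Avoids S)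
      step S ih i = begin
        K * count (λ v → Avoids S v ∧ B i v)          ≤⟨ *-monoʳ-≤ K (count-mono λ v h → ∧-intro (Avoids-anti (λ _ → ∧-elimˡ) v (∧-elimˡ h)) (∧-elimʳ h)) ⟩
        K * count (λ v → Avoids (far i S) v ∧ B i v)  ≤⟨ isolated (far i S) i (λ _ → ∧-elimʳ) ⟩
        count (Avoids (far i S))                      ≤⟨ far-double S i (λ j nj → ih (far i S) (far-smaller S i j nj) j) ⟩
        2 * count (Avoids S)                          ∎
        where open ≤-Reasoning

    _without_ : Subset m → Fin m → Subset m
    (S without j₀) j = S j ∧ not (does (j ≟ j₀))

    without-smaller : ∀ S j₀ → S j₀ ≡ true → size (S without j₀) < size S
    without-smaller S j₀ s = size-strict (λ _ → ∧-elimˡ) j₀ s removed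
      where
      removed : S j₀ ∧ not (does (j₀ ≟ j₀)) ≡ false
      removed rewrite dec-true (j₀ ≟ j₀) refl = ∧-zeroʳ (S j₀)

    without-cover : ∀ S j₀ v → Avoids (S without j₀) v ≡ true →
                    (Avoids S v ∨ (Avoids (S without j₀) v ∧ B j₀ v)) ≡ true
    without-cover S j₀ v h with B j₀ v in bj₀
    ... | true  rewrite h = ∨-zeroʳ (Avoids S v)
    ... | false = cong (_∨ (Avoids (S without j₀) v ∧ false)) (Avoids-intro S v others)
      where
      others : ∀ j → S j ≡ true → B j v ≡ false
      others j s with j ≟ j₀
      ... | yes refl = bj₀
      ... | no  j≢j₀ = Avoids-elim (S without j₀) v h j (∧-intro s (cong not (dec-false (j ≟ j₀) j≢j₀)))

    without-double : ∀ S j₀ → count (Avoids (S without j₀)) ≤ 2 * count (Avoids S)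
    without-double S j₀ = absorb-half {y = count (Avoids S)} {z = α} split half
      where
      A α : ℕ
      A = count (Avoids (S without j₀))
      α = count (λ v → Avoids (S without j₀) v ∧ B j₀ v)
      split : A ≤ count (Avoids S) + α
      split = ≤-trans (count-mono (without-cover S j₀)) (count-∨ (Avoids S) _)
      half : 2 * α ≤ A
      half = *-cancelˡ-≤ 2 (begin
        2 * (2 * α)  ≡⟨ *-assoc 2 2 α ⟨
        4 * α        ≤⟨ *-monoˡ-≤ α 4≤K ⟩
        K * α        ≤⟨ conditional (S without j₀) j₀ ⟩
        2 * A        ∎)
        where open ≤-Reasoning

    positive : ∀ S → 0 < count (Avoids S)
    positive = size-induction _ step
      where
      step : ∀ S → (∀ S′ → size S′ < size S → 0 < count (Avoids S′)) → 0 < count (Avoids S)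
      step S ih with anyᵇ S in nonempty
      ... | false = begin-strict
        0                        <⟨ m^n>0 k n ⟩
        k ^ n                    ≡⟨ count-true n ⟨
        count {n} (λ _ → true)   ≤⟨ count-mono (λ v _ → Avoids-intro S v λ j s → absurd (trans (sym (anyᵇ-elim S nonempty j)) s)) ⟩
        count (Avoids S)         ∎
        where
        open ≤-Reasoning
        absurd : ∀ {A : Set} → false ≡ true → A
        absurd ()
      ... | true with anyᵇ-witness S nonempty
      ...   | j₀ , s = *-cancelˡ-< 2 0 _ (≤-trans (ih (S without j₀) (without-smaller S j₀ s)) (without-double S j₀))

    avoiding-colouring : ∃ λ v → ∀ j → B j v ≡ false
    avoiding-colouring with count-witness (Avoids (λ _ → true)) (positive (λ _ → true))
    ... | v , avoidsAll = v , λ j → Avoids-elim _ v avoidsAll j refl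

  Monochromatic-false : ∀ {n} (X : Subset n) v → Monochromatic X v ≡ false →
                        ∀ a → ∃ λ w → X w ≡ true × v w ≢ v a
  Monochromatic-false X v h a with allᵇ-false _ (anyᵇ-elim _ h (v a))
  ... | w , fails with X w in x | v w ≟ v a
  ...   | true | no differs = w , x , differs
  Monochromatic-false X v h a | w , () | true  | yes _
  Monochromatic-false X v h a | w , () | false | _

length-filter-tabulate : ∀ {A : Set} {m} (f : Fin m → A) (p : A → Bool) →
                         length (filterᵇ p (tabulate f)) ≡ size (p ∘ f)
length-filter-tabulate {m = zero}  f p = refl
length-filter-tabulate {m = suc m} f p with p (f zero)
... | true  = cong suc (length-filter-tabulate (f ∘ suc) p)
... | false = length-filter-tabulate (f ∘ suc) p

degree≡size : ∀ {n} (G : SimpleGraph n) v → degree G v ≡ size (adj G v)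
degree≡size G v = length-filter-tabulate (λ w → w) (adj G v)

neighbourhood-colouring : ∀ {n} (G : SimpleGraph n) (δ Δ k : ℕ) .{{_ : NonZero k}} →
  (∀ v → suc δ ≤ degree G v) → (∀ v → degree G v ≤ Δ) → 1 ≤ Δ → 4 * (Δ * Δ) ≤ k ^ δ →
  ∃ λ (col : Fin n → Fin k) → ∀ u → Colourings.Monochromatic k (adj G u) col ≡ false
neighbourhood-colouring {n} G δ Δ k minDeg maxDeg 1≤Δ 4Δ²≤K =
  avoiding-colouring
  where
  open Colourings k
  K : ℕ
  K = k ^ δ
  rare : ∀ u → K * count (Monochromatic (adj G u)) ≤ k ^ n
  rare u = *-cancelˡ-≤ k (begin
    k * (K * count (Monochromatic (adj G u)))     ≡⟨ *-assoc k K _ ⟨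
    k ^ suc δ * count (Monochromatic (adj G u))   ≤⟨ *-monoˡ-≤ _ (^-monoʳ-≤ k (subst (suc δ ≤_) (degree≡size G u) (minDeg u))) ⟩
    k ^ size (adj G u) * count (Monochromatic (adj G u)) ≤⟨ count-Monochromatic (adj G u) ⟩
    k * k ^ n                                     ∎)
    where open ≤-Reasoning
  support : ∀ u → size (adj G u) ≤ Δ
  support u = subst (_≤ Δ) (degree≡size G u) (maxDeg u)
  multiplicity : ∀ w → size (λ u → adj G u w) ≤ Δ
  multiplicity w = ≤-trans (size-mono λ u a → trans (symm G w u) a) (support w)
  4≤K : 4 ≤ K
  4≤K = ≤-trans (*-monoʳ-≤ 4 (*-mono-≤ 1≤Δ 1≤Δ)) 4Δ²≤K
  open LocalLemma K Δ Δ (λ u → Monochromatic (adj G u)) (adj G) (λ u → Monochromatic-dependsOn (adj G u))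
                  support multiplicity rare 4≤K 4Δ²≤K

colours-nonzero : ∀ {Δ} k e → 1 ≤ Δ → 4 * Δ ^ 2 ≤ k ^ suc e → NonZero k
colours-nonzero {suc Δ} zero    e _ ()
colours-nonzero         (suc k) e _ _ = _

-- The theorem: colour all vertices as in neighbourhood-colouring (with δ - 1
-- in place of δ) and restrict to T.  Only the bound 4Δ² ≤ k^(δ-1) of the
-- ceiling is used.
lemma5 : ∀ {n} (G : SimpleGraph n) (δ Δ : ℕ) → IsMinDegree G δ → IsMaxDegree G Δ → 2 ≤ δ →
         (T : Fin n → Bool) → IsIndependent G T →
         (k : ℕ) → IsCeilRoot (δ ∸ 1) (4 * Δ ^ 2) k →
         Σ ((v : Fin n) → T v ≡ true → Fin k) λ c →
           ∀ (u : Fin n) → (∀ w → adj G u w ≡ true → T w ≡ true) →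
             ∃ λ w₁ → ∃ λ w₂ → Σ (adj G u w₁ ≡ true) λ a₁ → Σ (adj G u w₂ ≡ true) λ a₂ →
               Σ (T w₁ ≡ true) λ t₁ → Σ (T w₂ ≡ true) λ t₂ → c w₁ t₁ ≢ c w₂ t₂
lemma5 {n} G (suc (suc δ)) Δ ((v₀ , degree-v₀) , minDeg) (_ , maxDeg) (s≤s (s≤s z≤n)) T _ k (4Δ²≤K , _) =
  (λ w _ → col w) , twoColours
  where
  1≤Δ : 1 ≤ Δ
  1≤Δ = ≤-trans (s≤s z≤n) (subst (_≤ Δ) degree-v₀ (maxDeg v₀))
  instance
    k≢0 : NonZero k
    k≢0 = colours-nonzero k δ 1≤Δ 4Δ²≤K
  open Colourings k using (Monochromatic; Monochromatic-false)
  colouring : ∃ λ (col : Fin n → Fin k) → ∀ u → Monochromatic (adj G u) col ≡ false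
  colouring = neighbourhood-colouring G (suc δ) Δ k minDeg maxDeg 1≤Δ
                (subst (λ Δ² → 4 * Δ² ≤ k ^ suc δ) (cong (Δ *_) (*-identityʳ Δ)) 4Δ²≤K)
  col : Fin n → Fin k
  col = proj₁ colouring
  twoColours : ∀ u → (∀ w → adj G u w ≡ true → T w ≡ true) →
    ∃ λ w₁ → ∃ λ w₂ → Σ (adj G u w₁ ≡ true) λ a₁ → Σ (adj G u w₂ ≡ true) λ a₂ →
      Σ (T w₁ ≡ true) λ t₁ → Σ (T w₂ ≡ true) λ t₂ → col w₁ ≢ col w₂
  twoColours u N⊆T with size-witness (adj G u) (subst (0 <_) (degree≡size G u) (≤-trans (s≤s z≤n) (minDeg u)))
  ... | a , ua with Monochromatic-false (adj G u) col (proj₂ colouring u) a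
  ...   | w , uw , differs = w , a , uw , ua , N⊆T w uw , N⊆T a ua , differs
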